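{- For every $k\ge 1$, the LZ77 factorization of the $k$-th period-doubling sequence $S_k$ is $(S_0, \widehat{S_0}, \widehat{S_1}, \ldots, \widehat{S_{k-1}})$; hence the number of LZ77 phrases of $S_k$ is $k+1$.
   Context: Strings are over the binary alphabet $\{a,b\}$. For $c\in\{a,b\}$, $\overline{c}$ is the other letter; for a nonempty string $w$, $\widehat{w} = w[1..|w|-1]\cdot\overline{w[|w|]}$. The period-doubling sequences are $S_0=a$ and $S_k = S_{k-1}\widehat{S_{k-1}}$ for $k\ge 1$. The LZ77 factorization (non-overlapping, without self-references) of a string $w$ is the factorization $w=p_1\cdots p_z$ built greedily from left to right such that, for each $i$, $p_i[1..|p_i|-1]$ is the longest prefix of $p_i\cdots p_z$ that occurs as a substring of $p_1\cdots p_{i-1}$ (and $p_i$ is that prefix extended by one more character); as an exception, the last phrase $p_z$ may be a suffix of $w$ that occurs in $p_1\cdots p_{z-1}$. -}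

module Defs where

open import Data.Nat using (ℕ; zero; suc; _≤_; _∸_)
open import Data.List using (List; []; _∷_; _++_; length; concat; map; upTo)
open import Data.Product using (Σ; ∃; _×_; _,_)
open import Data.Sum using (_⊎_)
open import Relation.Binary.PropositionalEquality using (_≡_; _≢_)

data Letter : Set where
  a b : Letter

Str : Set
Str = List Letter

flip : Letter → Letter
flip a = b
flip b = a

-- ŵ : flip the last letter (identity on the empty string, which never occurs below)
hat : Str → Str
hat [] = []
hat (c ∷ []) = flip c ∷ []
hat (c ∷ d ∷ w) = c ∷ hat (d ∷ w)

S : ℕ → Str
S zero = a ∷ []
S (suc k) = S k ++ hat (S k)

_OccursIn_ : Str → Str → Set
u OccursIn v = Σ Str λ x → Σ Str λ y → v ≡ x ++ u ++ y

_PrefixOf_ : Str → Str → Set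
u PrefixOf v = Σ Str λ y → v ≡ u ++ y

-- Regular LZ77 phrase p, given the already-factorized text `prev` and the
-- remaining text `rest` (which starts with p):  p = q·c where q is the longest
-- prefix of `rest` that occurs in `prev`.
RegularPhrase : Str → Str → Str → Set
RegularPhrase prev rest p =
  Σ Str λ q → Σ Letter λ c →
    (p ≡ q ++ c ∷ []) ×
    q OccursIn prev ×
    (∀ r → r PrefixOf rest → r OccursIn prev → length r ≤ length q)

-- IsLZ77From prev ps : ps is the LZ77 factorization (continuing after the
-- already factorized text prev) of the string concat ps.
data IsLZ77From (prev : Str) : List Str → Set where
  -- last phrase, exception: a nonempty suffix occurring in the previous text
  lastOcc : ∀ p → p ≢ [] → p OccursIn prev → IsLZ77From prev (p ∷ [])
  step : ∀ p ps → RegularPhrase prev (p ++ concat ps) p →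
         IsLZ77From (prev ++ p) ps → IsLZ77From prev (p ∷ ps)
  done : IsLZ77From prev []

IsLZ77 : Str → List Str → Set
IsLZ77 w ps = (concat ps ≡ w) × IsLZ77From [] ps

expectedFactorization : ℕ → List Str
expectedFactorization k = S 0 ∷ map (λ i → hat (S i)) (upTo k)

-- LZ77 factorizations are unique: a regular phrase is one letter longer than
-- the longest prefix of the remaining text that occurs earlier, which forces
-- its length, and it cannot compete with the exceptional last phrase, which
-- does occur earlier.  So it suffices to exhibit one factorization.  Writing
-- S_i = u·d, we have Ŝ_i = u·d̄; the prefix u of Ŝ_i occurs in S_i, while any
-- longer occurrence in S_i would be S_i itself, ending in d rather than d̄.  So
-- Ŝ_i is the regular phrase following S_i, and S_{i+1} = S_i·Ŝ_i repeats this.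
module Submission where

open import Defs
open import Data.Nat using (ℕ; zero; suc; _+_; _≤_; _<_; s≤s; _≤?_)
open import Data.Nat.Properties
  using (≤-trans; ≤-antisym; <-irrefl; ≤⇒≯; ≰⇒>; suc-injective; +-identityʳ; +-suc)
open import Data.List
  using (List; []; _∷_; _++_; _∷ʳ_; length; concat; applyUpTo; initLast; _∷ʳ′_)
open import Data.List.Properties
  using (++-assoc; ++-identityʳ; ++-cancelˡ; ++-cancelʳ; ++-conicalˡ; ++-conicalʳ;
         ∷-injectiveˡ; ∷-injectiveʳ; ∷ʳ-++; length-++-≤ˡ; length-++-≤ʳ; length-++-sucʳ;
         map-upTo)
open import Data.Product using (∃₂; _,_; _×_)
open import Data.Empty using (⊥-elim)
open import Relation.Nullary using (¬_; yes; no)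
open import Relation.Binary.PropositionalEquality
open ≡-Reasoning

++-injectiveˡ : ∀ {A : Set} (xs xs′ : List A) {ys ys′ : List A} →
  length xs ≡ length xs′ → xs ++ ys ≡ xs′ ++ ys′ → xs ≡ xs′
++-injectiveˡ []       []         _ _ = refl
++-injectiveˡ (x ∷ xs) (x′ ∷ xs′) l e =
  cong₂ _∷_ (∷-injectiveˡ e) (++-injectiveˡ xs xs′ (suc-injective l) (∷-injectiveʳ e))

length-∷ʳ : ∀ {A : Set} (xs : List A) x → length (xs ∷ʳ x) ≡ suc (length xs)
length-∷ʳ []       x = refl
length-∷ʳ (_ ∷ xs) x = cong suc (length-∷ʳ xs x)

∷ʳ-view : ∀ {A : Set} (xs : List A) → xs ≢ [] → ∃₂ λ ys y → xs ≡ ys ∷ʳ y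
∷ʳ-view xs xs≢[] with initLast xs
... | []       = ⊥-elim (xs≢[] refl)
... | ys ∷ʳ′ y = ys , y , refl

applyUpTo-cong : ∀ {A : Set} {f g : ℕ → A} → (∀ i → f i ≡ g i) → ∀ n →
  applyUpTo f n ≡ applyUpTo g n
applyUpTo-cong f≗g zero    = refl
applyUpTo-cong f≗g (suc n) = cong₂ _∷_ (f≗g 0) (applyUpTo-cong (λ i → f≗g (suc i)) n)

OccursIn-length : ∀ {u v} → u OccursIn v → length u ≤ length v
OccursIn-length {u} (x , y , refl) = ≤-trans (length-++-≤ˡ u {y}) (length-++-≤ʳ (u ++ y) {x})

OccursIn-full : ∀ {u v} → u OccursIn v → length v ≤ length u → u ≡ v
OccursIn-full {u} ([]    , []    , refl) _  = sym (++-identityʳ u)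
OccursIn-full {u} (_ ∷ x , y     , refl) le = ⊥-elim (≤⇒≯ (OccursIn-length (x , y , refl)) le)
OccursIn-full {u} ([]    , c ∷ y , refl) le =
  ⊥-elim (≤⇒≯ (length-++-≤ˡ u) (subst (_≤ length u) (length-++-sucʳ u c y) le))

PrefixOf-OccursIn : ∀ {u v w} → u PrefixOf v → v OccursIn w → u OccursIn w
PrefixOf-OccursIn {u} (t , refl) (x , y , refl) = x , t ++ y , cong (x ++_) (++-assoc u t y)

regularPhrase-nonempty : ∀ {prev rest p} → RegularPhrase prev rest p → p ≢ []
regularPhrase-nonempty (q , c , refl , _) e with ++-conicalʳ q (c ∷ []) e
... | ()

regularPhrase-maximal : ∀ {prev rest p r} → RegularPhrase prev rest p →
  r PrefixOf rest → r OccursIn prev → length r < length p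
regularPhrase-maximal {r = r} (q , c , refl , _ , maximal) r≤rest r∈prev =
  subst (length r <_) (sym (length-∷ʳ q c)) (s≤s (maximal r r≤rest r∈prev))

regularPhrase-≤ : ∀ {prev rest p p′} → RegularPhrase prev rest p → p PrefixOf rest →
  RegularPhrase prev rest p′ → length p ≤ length p′
regularPhrase-≤ (q , c , refl , q∈prev , _) (t , refl) rp′ =
  subst (_≤ _) (sym (length-∷ʳ q c)) (regularPhrase-maximal rp′ (c ∷ t , ∷ʳ-++ q c t) q∈prev)

regularPhrase-unique : ∀ {prev p p′ x x′} → RegularPhrase prev (p ++ x) p →
  RegularPhrase prev (p′ ++ x′) p′ → p ++ x ≡ p′ ++ x′ → p ≡ p′
regularPhrase-unique {prev} {p} {p′} {x} {x′} rp rp′ e =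
  ++-injectiveˡ p p′ (≤-antisym (regularPhrase-≤ rp (x , refl) rp′′) (regularPhrase-≤ rp′′ (x′ , e) rp)) e
  where
  rp′′ : RegularPhrase prev (p ++ x) p′
  rp′′ = subst (λ rest → RegularPhrase prev rest p′) (sym e) rp′

regularPhrase-rest-notOccurs : ∀ {prev p x} → RegularPhrase prev (p ++ x) p →
  ¬ (p ++ x) OccursIn prev
regularPhrase-rest-notOccurs {x = x} rp occ =
  <-irrefl refl (regularPhrase-maximal rp (x , refl) (PrefixOf-OccursIn (x , refl) occ))

IsLZ77From-unique : ∀ {prev ps ps′} → IsLZ77From prev ps → IsLZ77From prev ps′ →
  concat ps ≡ concat ps′ → ps ≡ ps′
IsLZ77From-unique done done _ = refl
IsLZ77From-unique done (lastOcc p p≢[] _) e = ⊥-elim (p≢[] (++-conicalˡ p [] (sym e)))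
IsLZ77From-unique done (step p _ rp _)    e = ⊥-elim (regularPhrase-nonempty rp (++-conicalˡ p _ (sym e)))
IsLZ77From-unique (lastOcc p p≢[] _) done e = ⊥-elim (p≢[] (++-conicalˡ p [] e))
IsLZ77From-unique (step p _ rp _)    done e = ⊥-elim (regularPhrase-nonempty rp (++-conicalˡ p _ e))
IsLZ77From-unique (lastOcc p _ _) (lastOcc p′ _ _) e = cong (_∷ []) (++-cancelʳ [] p p′ e)
IsLZ77From-unique (lastOcc p _ p∈prev) (step p′ _ rp′ _) e =
  ⊥-elim (regularPhrase-rest-notOccurs rp′ (subst (_OccursIn _) (trans (sym (++-identityʳ p)) e) p∈prev))
IsLZ77From-unique (step p _ rp _) (lastOcc p′ _ p′∈prev) e =
  ⊥-elim (regularPhrase-rest-notOccurs rp (subst (_OccursIn _) (trans (sym (++-identityʳ p′)) (sym e)) p′∈prev))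
IsLZ77From-unique (step p _ rp lz) (step p′ _ rp′ lz′) e with regularPhrase-unique rp rp′ e
... | refl = cong (p ∷_) (IsLZ77From-unique lz lz′ (++-cancelˡ p _ _ e))

IsLZ77-unique : ∀ {w ps ps′} → IsLZ77 w ps → IsLZ77 w ps′ → ps ≡ ps′
IsLZ77-unique (e , lz) (e′ , lz′) = IsLZ77From-unique lz lz′ (trans e (sym e′))

singleton-regularPhrase : ∀ c rest → RegularPhrase [] rest (c ∷ [])
singleton-regularPhrase c rest = [] , c , refl , ([] , [] , refl) , λ _ _ → OccursIn-length

flip-≢ : ∀ c → flip c ≢ c
flip-≢ a ()
flip-≢ b ()

hat-∷ʳ : ∀ u d → hat (u ∷ʳ d) ≡ u ∷ʳ flip d
hat-∷ʳ []          d = refl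
hat-∷ʳ (c ∷ [])    d = refl
hat-∷ʳ (c ∷ e ∷ u) d = cong (c ∷_) (hat-∷ʳ (e ∷ u) d)

flipLast-regularPhrase : ∀ u d R → RegularPhrase (u ∷ʳ d) ((u ∷ʳ flip d) ++ R) (u ∷ʳ flip d)
flipLast-regularPhrase u d R = u , flip d , refl , ([] , d ∷ [] , refl) , maximal
  where
  maximal : ∀ r → r PrefixOf ((u ∷ʳ flip d) ++ R) → r OccursIn (u ∷ʳ d) → length r ≤ length u
  maximal r (t , rest≡r++t) r∈ud with length r ≤? length u
  ... | yes r≤u = r≤u
  ... | no  r≰u = ⊥-elim (flip-≢ d (sym (∷-injectiveˡ (++-cancelˡ u _ _ ud++t≡ud̄++R))))
    where
    r≡ud : r ≡ u ∷ʳ d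
    r≡ud = OccursIn-full r∈ud (subst (_≤ length r) (sym (length-∷ʳ u d)) (≰⇒> r≰u))
    ud++t≡ud̄++R : u ++ d ∷ t ≡ u ++ flip d ∷ R
    ud++t≡ud̄++R = begin
      u ++ d ∷ t             ≡⟨ ∷ʳ-++ u d t ⟨
      (u ∷ʳ d) ++ t          ≡⟨ cong (_++ t) r≡ud ⟨
      r ++ t                 ≡⟨ rest≡r++t ⟨
      (u ∷ʳ flip d) ++ R     ≡⟨ ∷ʳ-++ u (flip d) R ⟩
      u ++ flip d ∷ R        ∎

S-nonempty : ∀ i → S i ≢ []
S-nonempty zero    ()
S-nonempty (suc i) e = S-nonempty i (++-conicalˡ (S i) _ e)

S-hat-regularPhrase : ∀ i R → RegularPhrase (S i) (hat (S i) ++ R) (hat (S i))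
S-hat-regularPhrase i R with ∷ʳ-view (S i) (S-nonempty i)
... | u , d , eq rewrite eq | hat-∷ʳ u d = flipLast-regularPhrase u d R

hatsFrom : ℕ → ℕ → List Str
hatsFrom i zero    = []
hatsFrom i (suc n) = hat (S i) ∷ hatsFrom (suc i) n

length-hatsFrom : ∀ i n → length (hatsFrom i n) ≡ n
length-hatsFrom i zero    = refl
length-hatsFrom i (suc n) = cong suc (length-hatsFrom (suc i) n)

hatsFrom-applyUpTo : ∀ i n → hatsFrom i n ≡ applyUpTo (λ j → hat (S (i + j))) n
hatsFrom-applyUpTo i zero    = refl
hatsFrom-applyUpTo i (suc n) = cong₂ _∷_
  (cong (λ j → hat (S j)) (sym (+-identityʳ i)))
  (trans (hatsFrom-applyUpTo (suc i) n) (applyUpTo-cong (λ j → cong (λ m → hat (S m)) (sym (+-suc i j))) n))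

S-++-concat-hatsFrom : ∀ i n → S i ++ concat (hatsFrom i n) ≡ S (i + n)
S-++-concat-hatsFrom i zero    = trans (++-identityʳ (S i)) (cong S (sym (+-identityʳ i)))
S-++-concat-hatsFrom i (suc n) = begin
  S i ++ hat (S i) ++ concat (hatsFrom (suc i) n) ≡⟨ ++-assoc (S i) (hat (S i)) _ ⟨
  S (suc i) ++ concat (hatsFrom (suc i) n)        ≡⟨ S-++-concat-hatsFrom (suc i) n ⟩
  S (suc i + n)                                   ≡⟨ cong S (+-suc i n) ⟨
  S (i + suc n)                                   ∎

IsLZ77From-S-hatsFrom : ∀ i n → IsLZ77From (S i) (hatsFrom i n)
IsLZ77From-S-hatsFrom i zero    = done
IsLZ77From-S-hatsFrom i (suc n) =
  step _ _ (S-hat-regularPhrase i _) (IsLZ77From-S-hatsFrom (suc i) n)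

IsLZ77-S : ∀ k → IsLZ77 (S k) (S 0 ∷ hatsFrom 0 k)
IsLZ77-S k = S-++-concat-hatsFrom 0 k ,
  step (S 0) _ (singleton-regularPhrase a _) (IsLZ77From-S-hatsFrom 0 k)

expectedFactorization-hatsFrom : ∀ k → expectedFactorization k ≡ S 0 ∷ hatsFrom 0 k
expectedFactorization-hatsFrom k =
  cong (S 0 ∷_) (trans (map-upTo (λ i → hat (S i)) k) (sym (hatsFrom-applyUpTo 0 k)))

proposition1 : (k : ℕ) → 1 ≤ k →
    IsLZ77 (S k) (expectedFactorization k) ×
    (∀ ps → IsLZ77 (S k) ps → ps ≡ expectedFactorization k) ×
    length (expectedFactorization k) ≡ suc k
proposition1 k _ = IsLZ77-expected , (λ ps lz → IsLZ77-unique lz IsLZ77-expected) ,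
  trans (cong length expected≡) (cong suc (length-hatsFrom 0 k))
  where
  expected≡ : expectedFactorization k ≡ S 0 ∷ hatsFrom 0 k
  expected≡ = expectedFactorization-hatsFrom k
  IsLZ77-expected : IsLZ77 (S k) (expectedFactorization k)
  IsLZ77-expected = subst (IsLZ77 (S k)) (sym expected≡) (IsLZ77-S k)
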